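{- For every $n\geq 8$ there exists a simple graph $G$ on $n$ vertices such that $G$ and its complement $\overline{G}$ are both connected and $rc(G)=rc(\overline{G})=2$; in particular the lower bound $rc(G)+rc(\overline{G})\geq 4$ (valid whenever $G$ and $\overline{G}$ are both connected) is attained for every $n\geq 8$.
   Context: All graphs are simple, finite and undirected. For a connected graph $G$, an edge coloring $c:E(G)\to\{1,\dots,k\}$ (adjacent edges may receive the same color) makes $G$ rainbow connected if for every two vertices $u,v$ there is a $u$–$v$ path whose edges have pairwise distinct colors; $rc(G)$ is the minimum such $k$. $\overline{G}$ denotes the complement of $G$. -}

module Defs where

open import Data.Nat using (ℕ; _<_)
open import Data.Fin using (Fin; _≟_)
open import Data.Bool using (Bool; true; false; not)
open import Data.List using (List; []; _∷_)
open import Data.List.Relation.Unary.Unique.Propositional using (Unique)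
open import Data.Product using (Σ; _×_; _,_; ∃; ∃-syntax)
open import Relation.Binary.PropositionalEquality using (_≡_; refl; sym; cong)
open import Relation.Nullary using (¬_; Dec; yes; no)

record Graph (n : ℕ) : Set where
  field
    adj   : Fin n → Fin n → Bool
    adj-sym   : ∀ u v → adj u v ≡ adj v u
    adj-irrefl : ∀ u → adj u u ≡ false
open Graph public

cadj : ∀ {n} → Graph n → Fin n → Fin n → Bool
cadj G u v with u ≟ v
... | yes _ = false
... | no  _ = not (adj G u v)

private
  cadj-sym : ∀ {n} (G : Graph n) u v → cadj G u v ≡ cadj G v u
  cadj-sym G u v with u ≟ v | v ≟ u
  ... | yes _ | yes _ = refl
  ... | yes p | no q = Data.Empty.⊥-elim (q (sym p))
    where import Data.Empty
  ... | no q | yes p = Data.Empty.⊥-elim (q (sym p))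
    where import Data.Empty
  ... | no _ | no _ = cong not (adj-sym G u v)

  cadj-irrefl : ∀ {n} (G : Graph n) u → cadj G u u ≡ false
  cadj-irrefl G u with u ≟ u
  ... | yes _ = refl
  ... | no q = Data.Empty.⊥-elim (q refl)
    where import Data.Empty

complement : ∀ {n} → Graph n → Graph n
complement G = record { adj = cadj G ; adj-sym = cadj-sym G ; adj-irrefl = cadj-irrefl G }

data Walk {n : ℕ} (G : Graph n) : Fin n → Fin n → Set where
  [_]  : (u : Fin n) → Walk G u u
  _∷⟨_⟩_ : ∀ {v w} (u : Fin n) → adj G u v ≡ true → Walk G v w → Walk G u w

vertices : ∀ {n} {G : Graph n} {u v} → Walk G u v → List (Fin n)
vertices [ u ] = u ∷ []
vertices (u ∷⟨ _ ⟩ p) = u ∷ vertices p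

IsPath : ∀ {n} {G : Graph n} {u v} → Walk G u v → Set
IsPath p = Unique (vertices p)

Connected : ∀ {n} → Graph n → Set
Connected {n} G = ∀ (u v : Fin n) → Σ (Walk G u v) IsPath

-- An edge colouring with k colours: a colour for each (unordered) pair,
-- given symmetrically; only its values on edges matter.
record EdgeColouring {n : ℕ} (G : Graph n) (k : ℕ) : Set where
  field
    col     : Fin n → Fin n → Fin k
    col-sym : ∀ u v → col u v ≡ col v u
open EdgeColouring public

edgeColours : ∀ {n k} {G : Graph n} {u v} → EdgeColouring G k → Walk G u v → List (Fin k)
edgeColours c [ u ] = []
edgeColours c (_∷⟨_⟩_ {v = v} u _ p) = col c u v ∷ edgeColours c p

RainbowPath : ∀ {n k} {G : Graph n} {u v} → EdgeColouring G k → Walk G u v → Set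
RainbowPath c p = IsPath p × Unique (edgeColours c p)

RainbowConnecting : ∀ {n k} {G : Graph n} → EdgeColouring G k → Set
RainbowConnecting {n} {G = G} c = ∀ (u v : Fin n) → ∃[ p ] RainbowPath {G = G} {u = u} {v = v} c p

RC : ∀ {n} → Graph n → ℕ → Set
RC G k = ∃[ c ] RainbowConnecting {k = k} {G = G} c

rc≡ : ∀ {n} → Graph n → ℕ → Set
rc≡ G k = RC G k × (∀ j → j < k → ¬ RC G j)

module Submission where

-- If every pair of distinct vertices is adjacent or joined by a
-- 2-path whose edges get different colours (a "two-step pair"), that edge or
-- path is a rainbow path; so a 2-colouring with this property makes G rainbow
-- connected (hence connected), and a single non-edge rules out 0 or 1 colours.
-- It therefore suffices to give G, 2-colourings of G and Ḡ, and a non-edge of each.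
--
-- n = 8 is one explicit graph, checked by exhaustive computation.  For n ≥ 9 the
-- vertices are five core vertices and two sides X, Y with |Y| ≤ |X| ≤ |Y| + 1:
-- X and Y are cliques of G, and in Ḡ the complete bipartite graph between them
-- is coloured 0 on a matching of "partners" and 1 elsewhere.  All other
-- adjacencies and colours depend only on the classes (core vertex, X or Y), so
-- most pairs are certified by a finite computation on 7 classes; the remaining
-- pairs of Ḡ are joined through a partner or a non-partner.

open import Defs
open import Data.Nat using (ℕ; zero; suc; _+_; _<_; _≤_; _≥_; s≤s; z≤n; _≡ᵇ_; _<?_)
open import Data.Nat.Properties using (+-comm; +-suc; m≤n⇒∃[o]m+o≡n; ≤-trans; ≤∧≢⇒<; ≤-pred; ≤-antisym; ≮⇒≥) renaming (_≟_ to _≟ℕ_)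
open import Data.Sum.Properties using (≡-dec; inj₁-injective; inj₂-injective)
open import Data.Fin using (Fin; toℕ; _≟_; _↑ˡ_; fromℕ<)
open import Data.Fin.Patterns using (0F; 1F; 2F; 3F; 4F; 5F; 6F)
open import Data.Fin.Properties using (+↔⊎; all?; any?; toℕ-fromℕ<; toℕ-injective; toℕ<n)
open import Data.Bool using (Bool; true; false; not; _∧_; _∨_; if_then_else_)
open import Data.Bool.Properties using (∨-comm) renaming (_≟_ to _≟ᵇ_)
open import Data.List using (List; []; _∷_)
open import Data.List.Relation.Unary.All using ([]; _∷_)
open import Data.List.Relation.Unary.AllPairs using ([]; _∷_)
open import Data.Product using (∃; ∃₂; ∃-syntax; _×_; _,_; proj₁; proj₂)
open import Data.Sum using (_⊎_; inj₁; inj₂)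
open import Data.Empty using (⊥-elim)
open import Relation.Binary.PropositionalEquality
  using (_≡_; _≢_; refl; sym; trans; cong; subst; subst₂)
open import Function.Bundles using (_↔_; Inverse)
open import Function.Properties.Inverse using (↔-refl)
open import Function.Construct.Composition using (_↔-∘_)
open import Data.Sum.Function.Propositional using (_⊎-↔_)
open import Relation.Nullary using (¬_; Dec; yes; no; ¬?)
open import Relation.Nullary.Decidable using (map′; _⊎-dec_; _×-dec_; _→-dec_; toWitness; does; dec-true; dec-false)
open import Relation.Binary.Definitions using (DecidableEquality)

data TwoStep {V : Set} {k : ℕ} (A : V → V → Bool) (C : V → V → Fin k) (u v : V) : Set where
  edge : A u v ≡ true → TwoStep A C u v
  path : ∀ w → A u w ≡ true → A w v ≡ true → C u w ≢ C w v → TwoStep A C u v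

TwoStep-sym : {V : Set} {k : ℕ} {A : V → V → Bool} {C : V → V → Fin k} →
  (∀ u v → A u v ≡ A v u) → (∀ u v → C u v ≡ C v u) →
  ∀ {u v} → TwoStep A C u v → TwoStep A C v u
TwoStep-sym A-sym C-sym {u} {v} (edge uv) = edge (trans (A-sym v u) uv)
TwoStep-sym A-sym C-sym {u} {v} (path w uw wv c≢) =
  path w (trans (A-sym v w) wv) (trans (A-sym w u) uw)
       (λ eq → c≢ (trans (C-sym u w) (trans (sym eq) (C-sym v w))))

TwoStep-map : {V W : Set} {k : ℕ} {A : V → V → Bool} {C : V → V → Fin k}
  {A′ : W → W → Bool} {C′ : W → W → Fin k} (φ : V → W) →
  (∀ a b → A′ (φ a) (φ b) ≡ A a b) → (∀ a b → C′ (φ a) (φ b) ≡ C a b) →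
  ∀ {u v} → TwoStep A C u v → TwoStep A′ C′ (φ u) (φ v)
TwoStep-map φ A-eq C-eq {u} {v} (edge uv) = edge (trans (A-eq u v) uv)
TwoStep-map φ A-eq C-eq {u} {v} (path w uw wv c≢) =
  path (φ w) (trans (A-eq u w) uw) (trans (A-eq w v) wv)
       (λ eq → c≢ (trans (sym (C-eq u w)) (trans eq (C-eq w v))))

twoStep? : ∀ {n k} (A : Fin n → Fin n → Bool) (C : Fin n → Fin n → Fin k) →
  Dec (∀ u v → u ≢ v → TwoStep A C u v)
twoStep? A C = all? λ u → all? λ v → ¬? (u ≟ v) →-dec map′ fromSum toSum
  ((A u v ≟ᵇ true) ⊎-dec any? λ w →
     (A u w ≟ᵇ true) ×-dec (A w v ≟ᵇ true) ×-dec ¬? (C u w ≟ C w v))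
  where
    fromSum : ∀ {u v} → A u v ≡ true ⊎ ∃[ w ] (A u w ≡ true × A w v ≡ true × C u w ≢ C w v) → TwoStep A C u v
    fromSum (inj₁ uv) = edge uv
    fromSum (inj₂ (w , uw , wv , c≢)) = path w uw wv c≢
    toSum : ∀ {u v} → TwoStep A C u v → A u v ≡ true ⊎ ∃[ w ] (A u w ≡ true × A w v ≡ true × C u w ≢ C w v)
    toSum (edge uv) = inj₁ uv
    toSum (path w uw wv c≢) = inj₂ (w , uw , wv , c≢)

adj⇒≢ : ∀ {n} (G : Graph n) {u v} → adj G u v ≡ true → u ≢ v
adj⇒≢ G {u} uv refl with trans (sym uv) (adj-irrefl G u)
... | ()

-- If every pair of distinct vertices is a two-step pair, the colouring is
-- rainbow connecting: the edge or the 2-path is itself a rainbow path.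
rainbow-from-twoStep : ∀ {n k} (G : Graph n) (c : EdgeColouring G k) →
  (∀ u v → u ≢ v → TwoStep (adj G) (col c) u v) → RainbowConnecting {G = G} c
rainbow-from-twoStep G c two u v with u ≟ v
... | yes refl = [ u ] , ([] ∷ []) , []
... | no u≢v with two u v u≢v
...   | edge uv = (u ∷⟨ uv ⟩ [ v ]) , ((adj⇒≢ G uv ∷ []) ∷ [] ∷ []) , ([] ∷ [])
...   | path w uw wv c≢ = (u ∷⟨ uw ⟩ (w ∷⟨ wv ⟩ [ v ])) ,
        ((adj⇒≢ G uw ∷ u≢v ∷ []) ∷ (adj⇒≢ G wv ∷ []) ∷ [] ∷ []) , ((c≢ ∷ []) ∷ [] ∷ [])

connected-from-rainbow : ∀ {n k} (G : Graph n) (c : EdgeColouring G k) →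
  RainbowConnecting {G = G} c → Connected G
connected-from-rainbow G c rb u v = proj₁ (rb u v) , proj₁ (proj₂ (rb u v))

no-RC0 : ∀ {n} (G : Graph n) → Fin n → ¬ RC G 0
no-RC0 G u (c , _) with col c u u
... | ()

-- With one colour every rainbow path has at most one edge, so a pair of
-- distinct non-adjacent vertices cannot be joined.
no-RC1 : ∀ {n} (G : Graph n) (u v : Fin n) → u ≢ v → adj G u v ≡ false → ¬ RC G 1
no-RC1 G u v u≢v uv (c , rb) with rb u v
... | [ _ ] , _ = u≢v refl
... | (_ ∷⟨ uv′ ⟩ [ _ ]) , _ with trans (sym uv′) uv
...   | ()
no-RC1 G u v u≢v uv (c , rb) | (_ ∷⟨ _ ⟩ (_ ∷⟨ _ ⟩ _)) , _ , ((c≢ ∷ _) ∷ _) = c≢ (one-colour _ _)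
  where
    one-colour : (a b : Fin 1) → a ≡ b
    one-colour 0F 0F = refl

HasNonEdge : ∀ {n} → Graph n → Set
HasNonEdge {n} G = ∃₂ λ (u v : Fin n) → u ≢ v × adj G u v ≡ false

rc≡2 : ∀ {n} (G : Graph n) → HasNonEdge G → RC G 2 → rc≡ G 2
rc≡2 G (u , v , u≢v , uv) rc2 = rc2 , λ where
  0 _ → no-RC0 G u
  1 _ → no-RC1 G u v u≢v uv
  (suc (suc _)) (s≤s (s≤s ()))

BothRc2 : ℕ → Set
BothRc2 n =
  ∃[ G ] (Connected {n} G × Connected (complement G) × rc≡ G 2 × rc≡ (complement G) 2)

criterion : ∀ {n} (G : Graph n) (c : EdgeColouring G 2) (c̄ : EdgeColouring (complement G) 2) →
  (∀ u v → u ≢ v → TwoStep (adj G) (col c) u v) →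
  (∀ u v → u ≢ v → TwoStep (adj (complement G)) (col c̄) u v) →
  HasNonEdge G → HasNonEdge (complement G) → BothRc2 n
criterion G c c̄ twoG twoḠ nonEdgeG nonEdgeḠ =
  G , connected-from-rainbow G c rbG , connected-from-rainbow (complement G) c̄ rbḠ ,
  rc≡2 G nonEdgeG (c , rbG) , rc≡2 (complement G) nonEdgeḠ (c̄ , rbḠ)
  where
    rbG : RainbowConnecting {G = G} c
    rbG = rainbow-from-twoStep G c twoG
    rbḠ : RainbowConnecting {G = complement G} c̄
    rbḠ = rainbow-from-twoStep (complement G) c̄ twoḠ

occurs : List (ℕ × ℕ) → ℕ → ℕ → Bool
occurs [] a b = false
occurs ((x , y) ∷ es) a b = ((a ≡ᵇ x) ∧ (b ≡ᵇ y)) ∨ occurs es a b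

listed : List (ℕ × ℕ) → ℕ → ℕ → Bool
listed es a b = occurs es a b ∨ occurs es b a

listed-sym : ∀ es a b → listed es a b ≡ listed es b a
listed-sym es a b = ∨-comm (occurs es a b) (occurs es b a)

colourOf : Bool → Fin 2
colourOf true = 1F
colourOf false = 0F

listGraph : ∀ n (es : List (ℕ × ℕ)) → (∀ (u : Fin n) → listed es (toℕ u) (toℕ u) ≡ false) → Graph n
listGraph n es loopless = record
  { adj = λ u v → listed es (toℕ u) (toℕ v)
  ; adj-sym = λ u v → listed-sym es (toℕ u) (toℕ v)
  ; adj-irrefl = loopless }

listColouring : ∀ {n} (G : Graph n) → List (ℕ × ℕ) → EdgeColouring G 2
listColouring G es = record
  { col = λ u v → colourOf (listed es (toℕ u) (toℕ v))
  ; col-sym = λ u v → cong colourOf (listed-sym es (toℕ u) (toℕ v)) }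

edges₈ : List (ℕ × ℕ)
edges₈ = (0 , 4) ∷ (0 , 6) ∷ (0 , 7) ∷ (1 , 2) ∷ (1 , 5) ∷ (1 , 6) ∷ (2 , 4) ∷
         (2 , 5) ∷ (2 , 7) ∷ (3 , 5) ∷ (3 , 7) ∷ (4 , 5) ∷ (4 , 6) ∷ (5 , 6) ∷ []

G₈ : Graph 8
G₈ = listGraph 8 edges₈ (toWitness {a? = all? λ u → listed edges₈ (toℕ u) (toℕ u) ≟ᵇ false} _)

c₈ : EdgeColouring G₈ 2
c₈ = listColouring G₈ ((0 , 4) ∷ (0 , 6) ∷ (2 , 7) ∷ (3 , 5) ∷ (3 , 7) ∷ (4 , 6) ∷ [])

c̄₈ : EdgeColouring (complement G₈) 2
c̄₈ = listColouring (complement G₈) ((0 , 1) ∷ (0 , 5) ∷ (1 , 3) ∷ (2 , 6) ∷ (3 , 4) ∷ (5 , 7) ∷ [])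

case₈ : BothRc2 8
case₈ = criterion G₈ c₈ c̄₈
  (toWitness {a? = twoStep? (adj G₈) (col c₈)} _)
  (toWitness {a? = twoStep? (adj (complement G₈)) (col c̄₈)} _)
  (0F , 1F , (λ ()) , refl) (0F , 4F , (λ ()) , refl)

module Transport {V : Set} {n : ℕ} (e : Fin n ↔ V) where
  open Inverse e using (to; from; strictlyInverseˡ; strictlyInverseʳ)

  from-injective : ∀ {a b} → from a ≡ from b → a ≡ b
  from-injective {a} {b} eq = trans (sym (strictlyInverseˡ a)) (trans (cong to eq) (strictlyInverseˡ b))

  to-injective : ∀ {u v} → to u ≡ to v → u ≡ v
  to-injective {u} {v} eq = trans (sym (strictlyInverseʳ u)) (trans (cong from eq) (strictlyInverseʳ v))

  graph : (A : V → V → Bool) → (∀ a b → A a b ≡ A b a) → (∀ a → A a a ≡ false) → Graph n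
  graph A A-sym A-irrefl = record
    { adj = λ u v → A (to u) (to v)
    ; adj-sym = λ u v → A-sym (to u) (to v)
    ; adj-irrefl = λ u → A-irrefl (to u) }

  colouring : ∀ {k} (G : Graph n) (C : V → V → Fin k) → (∀ a b → C a b ≡ C b a) → EdgeColouring G k
  colouring G C C-sym = record { col = λ u v → C (to u) (to v) ; col-sym = λ u v → C-sym (to u) (to v) }

  graph-from : ∀ A A-sym A-irrefl a b → adj (graph A A-sym A-irrefl) (from a) (from b) ≡ A a b
  graph-from A _ _ a b rewrite strictlyInverseˡ a | strictlyInverseˡ b = refl

  complement-from : ∀ A A-sym A-irrefl (Ā : V → V → Bool) → (∀ a → Ā a a ≡ false) →
    (∀ a b → a ≢ b → Ā a b ≡ not (A a b)) →
    ∀ a b → adj (complement (graph A A-sym A-irrefl)) (from a) (from b) ≡ Ā a b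
  complement-from A A-sym A-irrefl Ā Ā-irrefl Ā-compl a b with from a ≟ from b
  ... | yes eq rewrite from-injective eq = sym (Ā-irrefl b)
  ... | no ne = trans (cong not (graph-from A A-sym A-irrefl a b))
                      (sym (Ā-compl a b (λ eq → ne (cong from eq))))

  colouring-from : ∀ {k} G C C-sym a b → col (colouring {k} G C C-sym) (from a) (from b) ≡ C a b
  colouring-from G C _ a b rewrite strictlyInverseˡ a | strictlyInverseˡ b = refl

  twoStep-transport : ∀ {k} (G : Graph n) (c : EdgeColouring G k) {A : V → V → Bool} {C : V → V → Fin k} →
    (∀ a b → adj G (from a) (from b) ≡ A a b) → (∀ a b → col c (from a) (from b) ≡ C a b) →
    (∀ a b → a ≢ b → TwoStep A C a b) → ∀ u v → u ≢ v → TwoStep (adj G) (col c) u v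
  twoStep-transport G c A-eq C-eq two u v u≢v =
    subst₂ (TwoStep (adj G) (col c)) (strictlyInverseʳ u) (strictlyInverseʳ v)
      (TwoStep-map {A′ = adj G} {C′ = col c} from A-eq C-eq (two (to u) (to v) λ eq → u≢v (to-injective eq)))

  nonEdge-transport : (G : Graph n) {A : V → V → Bool} → (∀ a b → adj G (from a) (from b) ≡ A a b) →
    ∀ a b → a ≢ b → A a b ≡ false → HasNonEdge G
  nonEdge-transport G A-eq a b a≢b ab = from a , from b , (λ eq → a≢b (from-injective eq)) , trans (A-eq a b) ab

does-sym : {A : Set} (_≟A_ : DecidableEquality A) (a b : A) → does (a ≟A b) ≡ does (b ≟A a)
does-sym _≟A_ a b with a ≟A b | b ≟A a
... | yes _ | yes _ = refl
... | no _  | no _  = refl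
... | yes eq | no ne = ⊥-elim (ne (sym eq))
... | no ne | yes eq = ⊥-elim (ne (sym eq))

allBool? : {P : Bool → Set} → ((b : Bool) → Dec (P b)) → Dec (∀ b → P b)
allBool? P? with P? false | P? true
... | yes f | yes t = yes λ where false → f ; true → t
... | no ¬f | _     = no λ h → ¬f (h false)
... | yes _ | no ¬t = no λ h → ¬t (h true)

-- V is partitioned into c classes (each with a chosen representative).  Two
-- distinct vertices are adjacent according to a class table F, and an edge gets
-- a colour determined by the classes of its ends and one extra bit of the pair.
module ClassGraph {V : Set} (_≟V_ : DecidableEquality V) {c : ℕ} (cls : V → Fin c)
                  (rep : Fin c → V) (cls-rep : ∀ m → cls (rep m) ≡ m)
                  (bit : V → V → Bool) (bit-sym : ∀ u v → bit u v ≡ bit v u) where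

  classAdj : (Fin c → Fin c → Bool) → V → V → Bool
  classAdj F u v = if does (u ≟V v) then false else F (cls u) (cls v)

  classCol : (Fin c → Fin c → Bool → Fin 2) → V → V → Fin 2
  classCol H u v = H (cls u) (cls v) (bit u v)

  classAdj-≢ : ∀ F {u v} → u ≢ v → classAdj F u v ≡ F (cls u) (cls v)
  classAdj-≢ F {u} {v} u≢v rewrite dec-false (u ≟V v) u≢v = refl

  classAdj-irrefl : ∀ F u → classAdj F u u ≡ false
  classAdj-irrefl F u rewrite dec-true (u ≟V u) refl = refl

  classAdj-sym : ∀ F → (∀ k l → F k l ≡ F l k) → ∀ u v → classAdj F u v ≡ classAdj F v u
  classAdj-sym F F-sym u v rewrite does-sym _≟V_ u v | F-sym (cls u) (cls v) = refl

  classCol-sym : ∀ H → (∀ k l s → H k l s ≡ H l k s) → ∀ u v → classCol H u v ≡ classCol H v u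
  classCol-sym H H-sym u v rewrite bit-sym u v = H-sym (cls u) (cls v) (bit v u)

  classAdj-not : ∀ F {u v} → u ≢ v → classAdj (λ k l → not (F k l)) u v ≡ not (classAdj F u v)
  classAdj-not F u≢v rewrite classAdj-≢ (λ k l → not (F k l)) u≢v | classAdj-≢ F u≢v = refl

  Middle : (Fin c → Fin c → Bool) → (Fin c → Fin c → Bool → Fin 2) → Fin c → Fin c → Fin c → Set
  Middle F H k l m = m ≢ k × m ≢ l × F k m ≡ true × F m l ≡ true × (∀ s t → H k m s ≢ H m l t)

  ClassCert : (Fin c → Fin c → Bool) → (Fin c → Fin c → Bool → Fin 2) → Fin c → Fin c → Set
  ClassCert F H k l = F k l ≡ true ⊎ ∃ (Middle F H k l)

  classCert? : ∀ F H k l → Dec (ClassCert F H k l)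
  classCert? F H k l = (F k l ≟ᵇ true) ⊎-dec any? λ m →
    ¬? (m ≟ k) ×-dec ¬? (m ≟ l) ×-dec (F k m ≟ᵇ true) ×-dec (F m l ≟ᵇ true) ×-dec
    allBool? λ s → allBool? λ t → ¬? (H k m s ≟ H m l t)

  via : ∀ {F H u v} w → Middle F H (cls u) (cls v) (cls w) → TwoStep (classAdj F) (classCol H) u v
  via {F} {H} {u} {v} w (w≢u , w≢v , uw , wv , H≢) =
    path w (trans (classAdj-≢ F (λ eq → w≢u (cong cls (sym eq)))) uw)
           (trans (classAdj-≢ F (λ eq → w≢v (cong cls eq))) wv) (H≢ (bit u w) (bit w v))

  fromClassCert : ∀ {F H u v} → u ≢ v → ClassCert F H (cls u) (cls v) → TwoStep (classAdj F) (classCol H) u v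
  fromClassCert {F} u≢v (inj₁ uv) = edge (trans (classAdj-≢ F u≢v) uv)
  fromClassCert {F} {H} u≢v (inj₂ (m , mid)) = via {F} {H} (rep m) (subst (Middle F H _ _) (sym (cls-rep m)) mid)

pattern core i = inj₁ i
pattern xv i = inj₂ (inj₁ i)
pattern yv j = inj₂ (inj₂ j)

pairColour : Bool → Fin 2
pairColour partners = colourOf (not partners)

partner-colour : ∀ {a b} → a ≡ b → pairColour (does (a ≟ℕ b)) ≡ 0F
partner-colour {a} {b} eq rewrite dec-true (a ≟ℕ b) eq = refl

stranger-colour : ∀ {a b} → a ≢ b → pairColour (does (a ≟ℕ b)) ≡ 1F
stranger-colour {a} {b} ne rewrite dec-false (a ≟ℕ b) ne = refl

colours-differ : ∀ {x y : Fin 2} → x ≡ 0F → y ≡ 1F → x ≢ y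
colours-differ refl refl ()

one-below : ∀ {m a b} → a < suc m → b < suc m → a ≢ b → a < m ⊎ b < m
one-below {m} {a} {b} a≤m b≤m a≢b with a <? m
... | yes a<m = inj₁ a<m
... | no a≮m = inj₂ (≤∧≢⇒< (≤-pred b≤m) λ b≡m → a≢b (trans (≤-antisym (≤-pred a≤m) (≮⇒≥ a≮m)) (sym b≡m)))

partnerOf : ∀ {m m′} (i : Fin m) → toℕ i < m′ → ∃[ i′ ] (toℕ {m′} i′ ≡ toℕ i)
partnerOf i i<m′ = fromℕ< i<m′ , toℕ-fromℕ< i<m′

otherIndex : ∀ {m} (a : ℕ) → ∃[ k ] (toℕ {2 + m} k ≢ a)
otherIndex zero = 1F , λ ()
otherIndex (suc a) = 0F , λ ()

module Family (q p : ℕ) (p≤q : p ≤ q) (q≤1+p : q ≤ suc p) where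

  Vertex : Set
  Vertex = Fin 5 ⊎ (Fin (2 + q) ⊎ Fin (2 + p))

  _≟V_ : DecidableEquality Vertex
  _≟V_ = ≡-dec _≟_ (≡-dec _≟_ _≟_)

  X Y : Fin 7
  X = 5F
  Y = 6F

  cls : Vertex → Fin 7
  cls (core i) = i ↑ˡ 2
  cls (xv _) = X
  cls (yv _) = Y

  rep : Fin 7 → Vertex
  rep 0F = core 0F
  rep 1F = core 1F
  rep 2F = core 2F
  rep 3F = core 3F
  rep 4F = core 4F
  rep 5F = xv 0F
  rep 6F = yv 0F

  cls-rep : ∀ m → cls (rep m) ≡ m
  cls-rep = λ where 0F → refl ; 1F → refl ; 2F → refl ; 3F → refl ; 4F → refl ; 5F → refl ; 6F → refl

  index : Vertex → ℕ
  index (core _) = 0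
  index (xv i) = toℕ i
  index (yv j) = toℕ j

  partners : Vertex → Vertex → Bool
  partners u v = does (index u ≟ℕ index v)

  open ClassGraph _≟V_ cls rep cls-rep partners (λ u v → does-sym _≟ℕ_ (index u) (index v))

  -- The class graph of G: X and Y are cliques with no edges between them.
  classEdges : List (ℕ × ℕ)
  classEdges = (0 , 5) ∷ (0 , 6) ∷ (1 , 4) ∷ (1 , 6) ∷ (2 , 3) ∷ (2 , 5) ∷
               (2 , 6) ∷ (3 , 4) ∷ (3 , 6) ∷ (4 , 5) ∷ (5 , 5) ∷ (6 , 6) ∷ []

  F F̄ : Fin 7 → Fin 7 → Bool
  F k l = listed classEdges (toℕ k) (toℕ l)
  F̄ k l = not (F k l)

  -- Colours in G depend on classes only; in the complement the complete
  -- bipartite graph between X and Y is coloured by the partner relation.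
  sidePair colouredG colouredC : List (ℕ × ℕ)
  sidePair = (5 , 6) ∷ []
  colouredG = (1 , 6) ∷ (2 , 5) ∷ (3 , 4) ∷ (3 , 6) ∷ (4 , 5) ∷ []
  colouredC = (0 , 4) ∷ (1 , 3) ∷ (1 , 5) ∷ (2 , 4) ∷ []

  HG HC : Fin 7 → Fin 7 → Bool → Fin 2
  HG k l _ = colourOf (listed colouredG (toℕ k) (toℕ l))
  HC k l s = if listed sidePair (toℕ k) (toℕ l) then pairColour s
             else colourOf (listed colouredC (toℕ k) (toℕ l))

  F-sym : ∀ k l → F k l ≡ F l k
  F-sym k l = listed-sym classEdges (toℕ k) (toℕ l)

  F̄-sym : ∀ k l → F̄ k l ≡ F̄ l k
  F̄-sym k l = cong not (F-sym k l)

  HG-sym : ∀ k l s → HG k l s ≡ HG l k s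
  HG-sym k l _ = cong colourOf (listed-sym colouredG (toℕ k) (toℕ l))

  HC-sym : ∀ k l s → HC k l s ≡ HC l k s
  HC-sym k l s rewrite listed-sym sidePair (toℕ k) (toℕ l) | listed-sym colouredC (toℕ k) (toℕ l) = refl

  A Ā : Vertex → Vertex → Bool
  A = classAdj F
  Ā = classAdj F̄

  colG colC : Vertex → Vertex → Fin 2
  colG = classCol HG
  colC = classCol HC

  bySides : {Adj : Vertex → Vertex → Bool} {Col : Vertex → Vertex → Fin 2} →
    (∀ u v → Adj u v ≡ Adj v u) → (∀ u v → Col u v ≡ Col v u) →
    (∀ i j → i ≢ j → TwoStep Adj Col (core i) (core j)) →
    (∀ i j → TwoStep Adj Col (core i) (xv j)) → (∀ i j → TwoStep Adj Col (core i) (yv j)) →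
    (∀ i j → i ≢ j → TwoStep Adj Col (xv i) (xv j)) → (∀ i j → TwoStep Adj Col (xv i) (yv j)) →
    (∀ i j → i ≢ j → TwoStep Adj Col (yv i) (yv j)) →
    ∀ u v → u ≢ v → TwoStep Adj Col u v
  bySides Adj-sym Col-sym cc cx cy xx xy yy = λ where
    (core i) (core j) ne → cc i j λ eq → ne (cong core eq)
    (core i) (xv j) _ → cx i j
    (core i) (yv j) _ → cy i j
    (xv i) (core j) _ → TwoStep-sym Adj-sym Col-sym (cx j i)
    (xv i) (xv j) ne → xx i j λ eq → ne (cong xv eq)
    (xv i) (yv j) _ → xy i j
    (yv i) (core j) _ → TwoStep-sym Adj-sym Col-sym (cy j i)
    (yv i) (xv j) _ → TwoStep-sym Adj-sym Col-sym (xy j i)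
    (yv i) (yv j) ne → yy i j λ eq → ne (cong yv eq)

  G-twoStep : ∀ u v → u ≢ v → TwoStep A colG u v
  G-twoStep = bySides (classAdj-sym F F-sym) (classCol-sym HG HG-sym)
    (λ i j i≢j → fromClassCert {F} {HG} (λ eq → i≢j (inj₁-injective eq)) (coreCore i j i≢j))
    (λ i j → fromClassCert {F} {HG} (λ ()) (coreX i))
    (λ i j → fromClassCert {F} {HG} (λ ()) (coreY i))
    (λ i j i≢j → fromClassCert {F} {HG} (λ eq → i≢j (inj₁-injective (inj₂-injective eq))) (inj₁ refl))
    (λ i j → fromClassCert {F} {HG} (λ ()) (toWitness {a? = classCert? F HG X Y} _))
    (λ i j i≢j → fromClassCert {F} {HG} (λ eq → i≢j (inj₂-injective (inj₂-injective eq))) (inj₁ refl))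
    where
      coreCore : ∀ i j → i ≢ j → ClassCert F HG (i ↑ˡ 2) (j ↑ˡ 2)
      coreCore = toWitness {a? = all? λ i → all? λ j → ¬? (i ≟ j) →-dec classCert? F HG (i ↑ˡ 2) (j ↑ˡ 2)} _
      coreX : ∀ i → ClassCert F HG (i ↑ˡ 2) X
      coreX = toWitness {a? = all? λ i → classCert? F HG (i ↑ˡ 2) X} _
      coreY : ∀ i → ClassCert F HG (i ↑ˡ 2) Y
      coreY = toWitness {a? = all? λ i → classCert? F HG (i ↑ˡ 2) Y} _

  -- In the complement a vertex reaches any other vertex of its side through its
  -- partner: the partner edge has colour 0 and the other edge colour 1.
  xx-partner : ∀ i j → ∃[ i′ ] (toℕ {2 + p} i′ ≡ toℕ i) → toℕ i ≢ toℕ j → TwoStep Ā colC (xv i) (xv j)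
  xx-partner i j (i′ , i′≡i) i≢j = path (yv i′) refl refl
    (colours-differ (partner-colour (sym i′≡i)) (stranger-colour λ eq → i≢j (trans (sym i′≡i) eq)))

  yy-partner : ∀ i j → ∃[ i′ ] (toℕ {2 + q} i′ ≡ toℕ i) → toℕ i ≢ toℕ j → TwoStep Ā colC (yv i) (yv j)
  yy-partner i j (i′ , i′≡i) i≢j = path (xv i′) refl refl
    (colours-differ (partner-colour (sym i′≡i)) (stranger-colour λ eq → i≢j (trans (sym i′≡i) eq)))

  -- The three core–side pairs of the complement that need a vertex of the other side
  -- chosen according to the partner relation.
  core1-y : ∀ j → TwoStep Ā colC (core 1F) (yv j)
  core1-y j with partnerOf {m′ = 2 + q} j (≤-trans (toℕ<n j) (s≤s (s≤s p≤q)))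
  ... | j′ , j′≡j = path (xv j′) refl refl λ eq → colours-differ (partner-colour j′≡j) refl (sym eq)

  core3-y : ∀ j → TwoStep Ā colC (core 3F) (yv j)
  core3-y j with otherIndex {q} (toℕ j)
  ... | k , k≢j = path (xv k) refl refl (colours-differ refl (stranger-colour k≢j))

  core4-x : ∀ j → TwoStep Ā colC (core 4F) (xv j)
  core4-x j with otherIndex {p} (toℕ j)
  ... | k , k≢j = path (yv k) refl refl (colours-differ refl (stranger-colour k≢j))

  Ḡ-twoStep : ∀ u v → u ≢ v → TwoStep Ā colC u v
  Ḡ-twoStep = bySides (classAdj-sym F̄ F̄-sym) (classCol-sym HC HC-sym)
    (λ i j i≢j → fromClassCert {F̄} {HC} (λ eq → i≢j (inj₁-injective eq)) (coreCore i j i≢j))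
    coreX coreY xx
    (λ i j → edge refl)
    yy
    where
      coreCore : ∀ i j → i ≢ j → ClassCert F̄ HC (i ↑ˡ 2) (j ↑ˡ 2)
      coreCore = toWitness {a? = all? λ i → all? λ j → ¬? (i ≟ j) →-dec classCert? F̄ HC (i ↑ˡ 2) (j ↑ˡ 2)} _

      coreX : ∀ i j → TwoStep Ā colC (core i) (xv j)
      coreX i j with toWitness {a? = all? λ i → (i ≟ 4F) ⊎-dec classCert? F̄ HC (i ↑ˡ 2) X} _ i
      ... | inj₁ refl = core4-x j
      ... | inj₂ cert = fromClassCert {F̄} {HC} (λ ()) cert

      coreY : ∀ i j → TwoStep Ā colC (core i) (yv j)
      coreY i j with toWitness {a? = all? λ i → (i ≟ 1F) ⊎-dec (i ≟ 3F) ⊎-dec classCert? F̄ HC (i ↑ˡ 2) Y} _ i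
      ... | inj₁ refl = core1-y j
      ... | inj₂ (inj₁ refl) = core3-y j
      ... | inj₂ (inj₂ cert) = fromClassCert {F̄} {HC} (λ ()) cert

      -- Of two distinct vertices of X (at most one more than |Y|) one has a partner.
      xx : ∀ i j → i ≢ j → TwoStep Ā colC (xv i) (xv j)
      xx i j i≢j with one-below (≤-trans (toℕ<n i) (s≤s (s≤s q≤1+p))) (≤-trans (toℕ<n j) (s≤s (s≤s q≤1+p)))
                                (λ eq → i≢j (toℕ-injective eq))
      ... | inj₁ i<P = xx-partner i j (partnerOf i i<P) (λ eq → i≢j (toℕ-injective eq))
      ... | inj₂ j<P = TwoStep-sym (classAdj-sym F̄ F̄-sym) (classCol-sym HC HC-sym)
                         (xx-partner j i (partnerOf j j<P) (λ eq → i≢j (toℕ-injective (sym eq))))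

      yy : ∀ i j → i ≢ j → TwoStep Ā colC (yv i) (yv j)
      yy i j i≢j = yy-partner i j (partnerOf i (≤-trans (toℕ<n i) (s≤s (s≤s p≤q)))) (λ eq → i≢j (toℕ-injective eq))

  N : ℕ
  N = 5 + ((2 + q) + (2 + p))

  numbering : Fin N ↔ Vertex
  numbering = (↔-refl ⊎-↔ +↔⊎) ↔-∘ +↔⊎

  open Transport numbering
  open Inverse numbering using (from)

  Gₙ : Graph N
  Gₙ = graph A (classAdj-sym F F-sym) (classAdj-irrefl F)

  cₙ : EdgeColouring Gₙ 2
  cₙ = colouring Gₙ colG (classCol-sym HG HG-sym)

  c̄ₙ : EdgeColouring (complement Gₙ) 2
  c̄ₙ = colouring (complement Gₙ) colC (classCol-sym HC HC-sym)

  Gₙ-from : ∀ a b → adj Gₙ (from a) (from b) ≡ A a b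
  Gₙ-from = graph-from A (classAdj-sym F F-sym) (classAdj-irrefl F)

  Ḡₙ-from : ∀ a b → adj (complement Gₙ) (from a) (from b) ≡ Ā a b
  Ḡₙ-from = complement-from A (classAdj-sym F F-sym) (classAdj-irrefl F) Ā (classAdj-irrefl F̄)
              (λ a b → classAdj-not F)

  family : BothRc2 N
  family = criterion Gₙ cₙ c̄ₙ
    (twoStep-transport Gₙ cₙ Gₙ-from (colouring-from Gₙ colG (classCol-sym HG HG-sym)) G-twoStep)
    (twoStep-transport (complement Gₙ) c̄ₙ Ḡₙ-from (colouring-from (complement Gₙ) colC (classCol-sym HC HC-sym)) Ḡ-twoStep)
    (nonEdge-transport Gₙ Gₙ-from (core 0F) (core 1F) (λ ()) refl)
    (nonEdge-transport (complement Gₙ) Ḡₙ-from (xv 0F) (xv 1F) (λ ()) refl)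

halves : ∀ m → ∃₂ λ q p → p ≤ q × q ≤ suc p × q + p ≡ m
halves zero = 0 , 0 , z≤n , z≤n , refl
halves (suc m) with halves m
... | q , p , p≤q , q≤1+p , q+p≡m = suc p , q , q≤1+p , s≤s p≤q , cong suc (trans (+-comm p q) q+p≡m)

family-size : ∀ q p → 5 + ((2 + q) + (2 + p)) ≡ 9 + (q + p)
family-size q p = cong (7 +_) (trans (+-suc q (suc p)) (cong suc (+-suc q p)))

theorem3 : ∀ (n : ℕ) → n ≥ 8 →
    ∃[ G ] (Connected {n} G × Connected (complement G) × rc≡ G 2 × rc≡ (complement G) 2)
theorem3 n n≥8 with m≤n⇒∃[o]m+o≡n n≥8
... | zero , refl = case₈
... | suc m , refl with halves m
...   | q , p , p≤q , q≤1+p , refl = subst BothRc2 (family-size q p) (Family.family q p p≤q q≤1+p)
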